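{- For every connected graph $G$ with at least one edge, at least one of Rules 1, 2, 3, 4 below applies to $G$.
   Context: $G-X$ denotes the subgraph induced by $V(G)\setminus X$. The rules (applied to a connected graph $G$): Rule 1 applies if there are $v\in V(G)$ and $X\subseteq V(G)$ such that $X$ is a connected component of $G-\{v\}$ and $X\cup\{v\}$ is a clique. Rule 2 applies if Rule 1 does not apply and there are $v\in V(G)$ and $X\subseteq V(G)$ such that $X$ is a connected component of $G-\{v\}$ and $X$ is a clique. Rule 3 applies if there are $a,b,c\in V(G)$ with $\{a,b\},\{b,c\}\in E(G)$, $\{a,c\}\notin E(G)$ and $G-\{a,b,c\}$ connected. Rule 4 applies if there are $x,y\in V(G)$ with $\{x,y\}\notin E(G)$ such that $G-\{x,y\}$ has exactly two connected components $X$ and $Y$, and $X\cup\{x\}$ and $X\cup\{y\}$ are cliques. -}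

module Defs where

open import Data.Nat using (ℕ)
open import Data.Fin using (Fin)
open import Data.Bool using (Bool; true; false)
open import Data.Fin.Subset using (Subset; _∈_; _∉_; _⊆_; ∁; ⁅_⁆; _∪_; Nonempty)
open import Data.Product using (Σ; ∃; _×_; _,_)
open import Data.Sum using (_⊎_)
open import Relation.Nullary using (¬_)
open import Relation.Binary.PropositionalEquality using (_≡_; _≢_)

record Graph (n : ℕ) : Set where
  field
    adj    : Fin n → Fin n → Bool
    adj-sym : ∀ u v → adj u v ≡ adj v u
    irrefl : ∀ v → adj v v ≡ false
open Graph public

module _ {n : ℕ} (G : Graph n) where

  Edge : Fin n → Fin n → Set
  Edge u v = adj G u v ≡ true

  data PathIn (S : Subset n) : Fin n → Fin n → Set where
    here : ∀ {u} → u ∈ S → PathIn S u u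
    step : ∀ {u w v} → u ∈ S → Edge u w → PathIn S w v → PathIn S u v

  ConnectedIn : Subset n → Set
  ConnectedIn S = ∀ u v → u ∈ S → v ∈ S → PathIn S u v

  Connected : Set
  Connected = ConnectedIn (∁ (Data.Fin.Subset.⊥))

  HasEdge : Set
  HasEdge = ∃ λ u → ∃ λ v → Edge u v

  Clique : Subset n → Set
  Clique X = ∀ u v → u ∈ X → v ∈ X → u ≢ v → Edge u v

  -- X is a connected component of the induced subgraph G[S]:
  -- a nonempty subset of S, inducing a connected subgraph, and closed
  -- under adjacency inside S (i.e. a maximal connected subset of S).
  ComponentOf : Subset n → Subset n → Set
  ComponentOf S X =
    X ⊆ S × Nonempty X × ConnectedIn X ×
    (∀ x y → x ∈ X → y ∈ S → Edge x y → y ∈ X)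

  ComponentMinus : Subset n → Subset n → Set
  ComponentMinus Y X = ComponentOf (∁ Y) X

  Rule1 : Set
  Rule1 = Σ (Fin n) λ v → Σ (Subset n) λ X →
    ComponentMinus ⁅ v ⁆ X × Clique (X ∪ ⁅ v ⁆)

  Rule2 : Set
  Rule2 = ¬ Rule1 × (Σ (Fin n) λ v → Σ (Subset n) λ X →
    ComponentMinus ⁅ v ⁆ X × Clique X)

  Rule3 : Set
  Rule3 = Σ (Fin n) λ a → Σ (Fin n) λ b → Σ (Fin n) λ c →
    Edge a b × Edge b c × a ≢ c × ¬ Edge a c ×
    ConnectedIn (∁ (⁅ a ⁆ ∪ ⁅ b ⁆ ∪ ⁅ c ⁆))

  Rule4 : Set
  Rule4 = Σ (Fin n) λ x → Σ (Fin n) λ y → x ≢ y × ¬ Edge x y ×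
    Σ (Subset n) λ X → Σ (Subset n) λ Y →
      ComponentMinus (⁅ x ⁆ ∪ ⁅ y ⁆) X ×
      ComponentMinus (⁅ x ⁆ ∪ ⁅ y ⁆) Y ×
      X ≢ Y ×
      (∀ w → w ∉ (⁅ x ⁆ ∪ ⁅ y ⁆) → w ∈ X ⊎ w ∈ Y) ×
      Clique (X ∪ ⁅ x ⁆) × Clique (X ∪ ⁅ y ⁆)

  SomeRuleApplies : Set
  SomeRuleApplies = Rule1 ⊎ Rule2 ⊎ Rule3 ⊎ Rule4

module Submission where

-- Central tool: for a vertex set A and z ∉ A let K_A(z) be z together with its
-- neighbours outside A.  If G − A has no induced P₃, then K_A(z) is a clique and the
-- component of z in G − A.  Hence, when G − (C ∪ {v}) is P₃-free, K(z) is a clique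
-- component of G − v (Rule 1 or 2) unless a vertex of it has a neighbour in C.
--
-- If G has no induced P₃ it is complete and Rule 1 or 2 applies.  Otherwise pick an
-- induced P₃ a – b – c and a connected set C avoiding it, and enlarge C (possibly
-- changing the P₃) until, for every neighbour w of C, G − (C ∪ {w}) is P₃-free.  Then
-- the only neighbours of C outside C are a, b, c.  If C and the P₃ cover G, Rule 3
-- applies; otherwise a case split on which of a, b, c have neighbours in C yields
-- Rule 1, 2 or 4.  The file follows this order: set bookkeeping, paths and cliques,
-- Rules 1 and 2, P₃-freeness and K_A(z), configurations, the case split, lemma6.

open import Defs
open import Data.Nat using (ℕ)
open import Data.Bool using (true)
import Data.Bool as Bool
open import Data.Fin using (Fin; _≟_)
open import Data.Fin.Properties using (any?; all?; ¬∀⟶∃¬)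
open import Data.Fin.Subset using (Subset; _∈_; _∉_; _⊆_; _⊃_; ∁; ⁅_⁆; _∪_; _∩_; Nonempty)
import Data.Fin.Subset as Subset
open import Data.Fin.Subset.Properties
  using (_∈?_; nonempty?; _⊆?_; anySubset?; x∈⁅x⁆; x∈⁅y⁆⇒x≡y; x≢y⇒x∉⁅y⁆; x∉⁅y⁆⇒x≢y;
         x∈p∪q⁻; x∈p∪q⁺; p⊆p∪q; q⊆p∪q; x∈p∩q⁻; x∈p∩q⁺; x∈∁p⇒x∉p; x∉p⇒x∈∁p; ∉⊥)
open import Data.Fin.Subset.Induction using (⊃-wellFounded; Acc; acc)
open import Data.Vec using (tabulate)
open import Data.Vec.Properties using (lookup∘tabulate; []=⇒lookup; lookup⇒[]=)
open import Data.Product using (∃; _×_; _,_; proj₁; proj₂)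
open import Data.Sum using (_⊎_; inj₁; inj₂)
open import Data.Empty using (⊥-elim)
open import Relation.Nullary using (¬_; Dec; yes; no)
open import Relation.Nullary.Decidable using (map′; _×-dec_; _⊎-dec_; _→-dec_; ¬?)
open import Relation.Binary.PropositionalEquality using (_≡_; _≢_; refl; sym; trans; subst)

private
  variable
    m : ℕ

∈∪⁅⁆⁻ : ∀ {x y : Fin m} (p : Subset m) → x ∈ p ∪ ⁅ y ⁆ → x ∈ p ⊎ x ≡ y
∈∪⁅⁆⁻ {y = y} p x∈ with x∈p∪q⁻ p ⁅ y ⁆ x∈
... | inj₁ x∈p = inj₁ x∈p
... | inj₂ x∈y = inj₂ (x∈⁅y⁆⇒x≡y y x∈y)

∉∪ : ∀ {x : Fin m} {p q : Subset m} → x ∉ p → x ∉ q → x ∉ p ∪ q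
∉∪ {p = p} {q} x∉p x∉q x∈ with x∈p∪q⁻ p q x∈
... | inj₁ x∈p = x∉p x∈p
... | inj₂ x∈q = x∉q x∈q

∉∪⁻ˡ : ∀ {x : Fin m} {p q : Subset m} → x ∉ p ∪ q → x ∉ p
∉∪⁻ˡ x∉ x∈p = x∉ (x∈p∪q⁺ (inj₁ x∈p))

∉∪⁻ʳ : ∀ {x : Fin m} (p : Subset m) {q : Subset m} → x ∉ p ∪ q → x ∉ q
∉∪⁻ʳ p x∉ x∈q = x∉ (x∈p∪q⁺ {p = p} (inj₂ x∈q))

∉∪⁅⁆ : ∀ {x y : Fin m} {p : Subset m} → x ∉ p → x ≢ y → x ∉ p ∪ ⁅ y ⁆
∉∪⁅⁆ x∉p x≢y = ∉∪ x∉p (x≢y⇒x∉⁅y⁆ x≢y)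

∪⁅⁆-⊆ : ∀ {y : Fin m} {p q : Subset m} → p ⊆ q → y ∈ q → p ∪ ⁅ y ⁆ ⊆ q
∪⁅⁆-⊆ {p = p} p⊆q y∈q x∈ with ∈∪⁅⁆⁻ p x∈
... | inj₁ x∈p = p⊆q x∈p
... | inj₂ refl = y∈q

∪-monoʳ : ∀ {p q r : Subset m} → q ⊆ r → p ∪ q ⊆ p ∪ r
∪-monoʳ {p = p} {q} q⊆r x∈ with x∈p∪q⁻ p q x∈
... | inj₁ x∈p = x∈p∪q⁺ (inj₁ x∈p)
... | inj₂ x∈q = x∈p∪q⁺ {p = p} (inj₂ (q⊆r x∈q))

∈V : (x : Fin m) → x ∈ ∁ Subset.⊥
∈V x = x∉p⇒x∈∁p ∉⊥

Among : Fin m → Fin m → Fin m → Fin m → Set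
Among a b c y = y ≡ a ⊎ y ≡ b ⊎ y ≡ c

among? : (a b c y : Fin m) → Dec (Among a b c y)
among? a b c y = (y ≟ a) ⊎-dec (y ≟ b) ⊎-dec (y ≟ c)

among⇒∉ : ∀ {a b c y : Fin m} {p : Subset m} → a ∉ p → b ∉ p → c ∉ p → Among a b c y → y ∉ p
among⇒∉ a∉ _ _ (inj₁ refl) = a∉
among⇒∉ _ b∉ _ (inj₂ (inj₁ refl)) = b∉
among⇒∉ _ _ c∉ (inj₂ (inj₂ refl)) = c∉

among-reverse : ∀ {a b c y : Fin m} → Among c b a y → Among a b c y
among-reverse (inj₁ y≡c) = inj₂ (inj₂ y≡c)
among-reverse (inj₂ (inj₁ y≡b)) = inj₂ (inj₁ y≡b)
among-reverse (inj₂ (inj₂ y≡a)) = inj₁ y≡a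

∈triple⁻ : ∀ {a b c y : Fin m} → y ∈ ⁅ a ⁆ ∪ ⁅ b ⁆ ∪ ⁅ c ⁆ → Among a b c y
∈triple⁻ {a = a} {b} {c} y∈ with x∈p∪q⁻ ⁅ a ⁆ (⁅ b ⁆ ∪ ⁅ c ⁆) y∈
... | inj₁ y∈a = inj₁ (x∈⁅y⁆⇒x≡y a y∈a)
... | inj₂ y∈bc with x∈p∪q⁻ ⁅ b ⁆ ⁅ c ⁆ y∈bc
...   | inj₁ y∈b = inj₂ (inj₁ (x∈⁅y⁆⇒x≡y b y∈b))
...   | inj₂ y∈c = inj₂ (inj₂ (x∈⁅y⁆⇒x≡y c y∈c))

∈triple⁺ : ∀ {a b c y : Fin m} → Among a b c y → y ∈ ⁅ a ⁆ ∪ ⁅ b ⁆ ∪ ⁅ c ⁆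
∈triple⁺ (inj₁ refl) = x∈p∪q⁺ (inj₁ (x∈⁅x⁆ _))
∈triple⁺ {a = a} (inj₂ (inj₁ refl)) = x∈p∪q⁺ {p = ⁅ a ⁆} (inj₂ (x∈p∪q⁺ (inj₁ (x∈⁅x⁆ _))))
∈triple⁺ {a = a} {b} (inj₂ (inj₂ refl)) =
  x∈p∪q⁺ {p = ⁅ a ⁆} (inj₂ (x∈p∪q⁺ {p = ⁅ b ⁆} (inj₂ (x∈⁅x⁆ _))))

module _ {n : ℕ} (G : Graph n) where

  edge? : ∀ u v → Dec (Edge G u v)
  edge? u v = adj G u v Bool.≟ true

  edge-sym : ∀ {u v} → Edge G u v → Edge G v u
  edge-sym {u} {v} uv = trans (adj-sym G v u) uv

  edge⇒≢ : ∀ {u v} → Edge G u v → u ≢ v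
  edge⇒≢ {u} uv refl with trans (sym uv) (irrefl G u)
  ... | ()

  N : Fin n → Subset n
  N z = tabulate (adj G z)

  ∈N⁺ : ∀ {z x} → Edge G z x → x ∈ N z
  ∈N⁺ {z} {x} zx = lookup⇒[]= x (N z) (trans (lookup∘tabulate (adj G z) x) zx)

  ∈N⁻ : ∀ {z x} → x ∈ N z → Edge G z x
  ∈N⁻ {z} {x} x∈ = trans (sym (lookup∘tabulate (adj G z) x)) ([]=⇒lookup x∈)

  Touches : Subset n → Fin n → Set
  Touches C s = ∃ λ x → x ∈ C × Edge G x s

  touches? : ∀ C s → Dec (Touches C s)
  touches? C s = any? λ x → (x ∈? C) ×-dec edge? x s

  path-mono : ∀ {S T u v} → S ⊆ T → PathIn G S u v → PathIn G T u v
  path-mono S⊆T (here u∈) = here (S⊆T u∈)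
  path-mono S⊆T (step u∈ e p) = step (S⊆T u∈) e (path-mono S⊆T p)

  _++_ : ∀ {S u v w} → PathIn G S u v → PathIn G S v w → PathIn G S u w
  here _ ++ q = q
  step u∈ e p ++ q = step u∈ e (p ++ q)

  head∈ : ∀ {S u v} → PathIn G S u v → u ∈ S
  head∈ (here u∈) = u∈
  head∈ (step u∈ _ _) = u∈

  last∈ : ∀ {S u v} → PathIn G S u v → v ∈ S
  last∈ (here v∈) = v∈
  last∈ (step _ _ p) = last∈ p

  exit : ∀ {S u v} (C : Subset n) → PathIn G S u v → u ∈ C → v ∉ C →
         ∃ λ x → ∃ λ y → x ∈ C × y ∉ C × Edge G x y
  exit C (here _) u∈ v∉ = ⊥-elim (v∉ u∈)
  exit C (step {w = w} _ e p) u∈ v∉ with w ∈? C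
  ... | yes w∈ = exit C p w∈ v∉
  ... | no w∉ = _ , w , u∈ , w∉ , e

  connected-extend : ∀ {C x w} → ConnectedIn G C → x ∈ C → Edge G x w → ConnectedIn G (C ∪ ⁅ w ⁆)
  connected-extend {C} {x} {w} conn x∈ xw u v u∈ v∈ with ∈∪⁅⁆⁻ C u∈ | ∈∪⁅⁆⁻ C v∈
  ... | inj₁ u∈C | inj₁ v∈C = path-mono (p⊆p∪q _) (conn u v u∈C v∈C)
  ... | inj₁ u∈C | inj₂ refl =
        path-mono (p⊆p∪q _) (conn u x u∈C x∈) ++ step (p⊆p∪q _ x∈) xw (here v∈)
  ... | inj₂ refl | inj₁ v∈C = step u∈ (edge-sym xw) (path-mono (p⊆p∪q _) (conn x v x∈ v∈C))
  ... | inj₂ refl | inj₂ refl = here u∈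

  clique? : ∀ X → Dec (Clique G X)
  clique? X = all? λ u → all? λ v → (u ∈? X) →-dec (v ∈? X) →-dec ¬? (u ≟ v) →-dec edge? u v

  clique-⊆ : ∀ {X Y} → X ⊆ Y → Clique G Y → Clique G X
  clique-⊆ X⊆Y clq u v u∈ v∈ u≢v = clq u v (X⊆Y u∈) (X⊆Y v∈) u≢v

  clique⇒connected : ∀ {X} → Clique G X → ConnectedIn G X
  clique⇒connected clq u v u∈ v∈ with u ≟ v
  ... | yes refl = here u∈
  ... | no u≢v = step u∈ (clq u v u∈ v∈ u≢v) (here v∈)

  Closed : Subset n → Subset n → Set
  Closed S X = ∀ x y → x ∈ X → y ∈ S → Edge G x y → y ∈ X

  closed? : ∀ S X → Dec (Closed S X)
  closed? S X = all? λ x → all? λ y → (x ∈? X) →-dec (y ∈? S) →-dec edge? x y →-dec (y ∈? X)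

  clique-component : ∀ {S X} → Clique G X → X ⊆ S → Nonempty X → Closed S X → ComponentOf G S X
  clique-component clq X⊆S ne cl = X⊆S , ne , clique⇒connected clq , cl

  -- Rule 1 with the connectivity of the component dropped; it is implied by the
  -- clique condition, and what remains is decidable.
  Rule1Witness : Fin n → Subset n → Set
  Rule1Witness v X =
    X ⊆ ∁ ⁅ v ⁆ × Nonempty X × Closed (∁ ⁅ v ⁆) X × Clique G (X ∪ ⁅ v ⁆)

  rule1? : Dec (Rule1 G)
  rule1? = map′ from to
    (any? λ v → anySubset? λ X →
      (X ⊆? ∁ ⁅ v ⁆) ×-dec nonempty? X ×-dec closed? (∁ ⁅ v ⁆) X ×-dec clique? (X ∪ ⁅ v ⁆))
    where
    from : (∃ λ v → ∃ λ X → Rule1Witness v X) → Rule1 G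
    from (v , X , X⊆ , ne , cl , clq) =
      v , X , clique-component (clique-⊆ (p⊆p∪q _) clq) X⊆ ne cl , clq
    to : Rule1 G → ∃ λ v → ∃ λ X → Rule1Witness v X
    to (v , X , (X⊆ , ne , _ , cl) , clq) = v , X , X⊆ , ne , cl , clq

  clique-component⇒rule : ∀ {v X} → ComponentMinus G ⁅ v ⁆ X → Clique G X → SomeRuleApplies G
  clique-component⇒rule {v} {X} comp clq with rule1?
  ... | yes r1 = inj₁ r1
  ... | no ¬r1 = inj₂ (inj₁ (¬r1 , v , X , comp , clq))

  InducedP3 : Fin n → Fin n → Fin n → Set
  InducedP3 a b c = Edge G a b × Edge G b c × a ≢ c × ¬ Edge G a c

  inducedP3? : ∀ a b c → Dec (InducedP3 a b c)
  inducedP3? a b c = edge? a b ×-dec edge? b c ×-dec ¬? (a ≟ c) ×-dec ¬? (edge? a c)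

  reverseP3 : ∀ {a b c} → InducedP3 a b c → InducedP3 c b a
  reverseP3 (ab , bc , a≢c , ¬ac) =
    edge-sym bc , edge-sym ab , (λ c≡a → a≢c (sym c≡a)) , (λ ca → ¬ac (edge-sym ca))

  HasP3Outside : Subset n → Set
  HasP3Outside A = ∃ λ p → ∃ λ q → ∃ λ r → p ∉ A × q ∉ A × r ∉ A × InducedP3 p q r

  hasP3Outside? : ∀ A → Dec (HasP3Outside A)
  hasP3Outside? A = any? λ p → any? λ q → any? λ r →
    ¬? (p ∈? A) ×-dec ¬? (q ∈? A) ×-dec ¬? (r ∈? A) ×-dec inducedP3? p q r

  -- G − A is P₃-free, stated as transitivity of adjacency between distinct vertices.
  P3Free : Subset n → Set
  P3Free A = ∀ {p q r} → p ∉ A → q ∉ A → r ∉ A → Edge G p q → Edge G q r → p ≢ r → Edge G p r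

  ¬HasP3Outside⇒P3Free : ∀ {A} → ¬ HasP3Outside A → P3Free A
  ¬HasP3Outside⇒P3Free none {p} {q} {r} p∉ q∉ r∉ pq qr p≢r with edge? p r
  ... | yes pr = pr
  ... | no ¬pr = ⊥-elim (none (p , q , r , p∉ , q∉ , r∉ , pq , qr , p≢r , ¬pr))

  P3Free-mono : ∀ {A B} → A ⊆ B → P3Free A → P3Free B
  P3Free-mono A⊆B free p∉ q∉ r∉ =
    free (λ p∈ → p∉ (A⊆B p∈)) (λ q∈ → q∉ (A⊆B q∈)) (λ r∈ → r∉ (A⊆B r∈))

  P3Free-path : ∀ {A p q} → P3Free A → PathIn G (∁ A) p q → p ≡ q ⊎ Edge G p q
  P3Free-path free (here _) = inj₁ refl
  P3Free-path {q = q} free (step {u = p} p∈ pw path) with P3Free-path free path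
  ... | inj₁ refl = inj₂ pw
  ... | inj₂ wq with p ≟ q
  ...   | yes p≡q = inj₁ p≡q
  ...   | no p≢q =
          inj₂ (free (x∈∁p⇒x∉p p∈) (x∈∁p⇒x∉p (head∈ path)) (x∈∁p⇒x∉p (last∈ path)) pw wq p≢q)

  -- The closed neighbourhood of z in G − A.  When G − A is P₃-free and z ∉ A,
  -- it is the connected component of z in G − A, and it is a clique.
  K : Subset n → Fin n → Subset n
  K A z = ⁅ z ⁆ ∪ (N z ∩ ∁ A)

  z∈K : ∀ {A} z → z ∈ K A z
  z∈K z = x∈p∪q⁺ (inj₁ (x∈⁅x⁆ z))

  ∈K⁺ : ∀ {A z x} → Edge G z x → x ∉ A → x ∈ K A z
  ∈K⁺ {z = z} zx x∉ = x∈p∪q⁺ {p = ⁅ z ⁆} (inj₂ (x∈p∩q⁺ (∈N⁺ zx , x∉p⇒x∈∁p x∉)))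

  ∈K⁻ : ∀ {A z x} → x ∈ K A z → x ≡ z ⊎ (Edge G z x × x ∉ A)
  ∈K⁻ {A} {z} x∈ with x∈p∪q⁻ ⁅ z ⁆ (N z ∩ ∁ A) x∈
  ... | inj₁ x∈z = inj₁ (x∈⁅y⁆⇒x≡y z x∈z)
  ... | inj₂ x∈N∖A with x∈p∩q⁻ (N z) (∁ A) x∈N∖A
  ...   | x∈N , x∈∁A = inj₂ (∈N⁻ x∈N , x∈∁p⇒x∉p x∈∁A)

  K-avoids : ∀ {A z x} → z ∉ A → x ∈ K A z → x ∉ A
  K-avoids z∉ x∈ with ∈K⁻ x∈
  ... | inj₁ refl = z∉
  ... | inj₂ (_ , x∉) = x∉

  K-antitone : ∀ {A B z} → A ⊆ B → K B z ⊆ K A z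
  K-antitone A⊆B x∈ with ∈K⁻ x∈
  ... | inj₁ refl = z∈K _
  ... | inj₂ (zx , x∉B) = ∈K⁺ zx (λ x∈A → x∉B (A⊆B x∈A))

  K-transfer : ∀ {A B z x} → x ∈ K A z → x ∉ B → x ∈ K B z
  K-transfer x∈ x∉B with ∈K⁻ x∈
  ... | inj₁ refl = z∈K _
  ... | inj₂ (zx , _) = ∈K⁺ zx x∉B

  K-clique : ∀ {A z} → P3Free A → z ∉ A → Clique G (K A z)
  K-clique {z = z} free z∉ u v u∈ v∈ u≢v with ∈K⁻ u∈ | ∈K⁻ v∈
  ... | inj₁ refl | inj₁ refl = ⊥-elim (u≢v refl)
  ... | inj₁ refl | inj₂ (zv , _) = zv
  ... | inj₂ (zu , _) | inj₁ refl = edge-sym zu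
  ... | inj₂ (zu , u∉) | inj₂ (zv , v∉) = free u∉ z∉ v∉ (edge-sym zu) zv u≢v

  K-closed : ∀ {A z} → P3Free A → z ∉ A → Closed (∁ A) (K A z)
  K-closed {z = z} free z∉ x y x∈ y∈ xy with y ≟ z
  ... | yes refl = z∈K _
  ... | no y≢z with ∈K⁻ x∈
  ...   | inj₁ refl = ∈K⁺ xy (x∈∁p⇒x∉p y∈)
  ...   | inj₂ (zx , x∉) =
          ∈K⁺ (free z∉ x∉ (x∈∁p⇒x∉p y∈) zx xy (λ z≡y → y≢z (sym z≡y))) (x∈∁p⇒x∉p y∈)

  component-or-touch : ∀ {C v z} → P3Free (C ∪ ⁅ v ⁆) → z ∉ C ∪ ⁅ v ⁆ →
    SomeRuleApplies G ⊎ ∃ λ s → s ∈ K (C ∪ ⁅ v ⁆) z × Touches C s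
  component-or-touch {C} {v} {z} free z∉ with any? (λ s → (s ∈? K (C ∪ ⁅ v ⁆) z) ×-dec touches? C s)
  ... | yes touching = inj₂ touching
  ... | no ¬touching = inj₁ (clique-component⇒rule component (K-clique free z∉))
    where
    avoids-v : K (C ∪ ⁅ v ⁆) z ⊆ ∁ ⁅ v ⁆
    avoids-v x∈ = x∉p⇒x∈∁p (∉∪⁻ʳ C (K-avoids z∉ x∈))
    closed : Closed (∁ ⁅ v ⁆) (K (C ∪ ⁅ v ⁆) z)
    closed x y x∈ y∈ xy with y ∈? C
    ... | yes y∈C = ⊥-elim (¬touching (x , x∈ , y , y∈C , edge-sym xy))
    ... | no y∉C = K-closed free z∉ x y x∈ (x∉p⇒x∈∁p (∉∪ y∉C (x∈∁p⇒x∉p y∈))) xy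
    component : ComponentMinus G ⁅ v ⁆ (K (C ∪ ⁅ v ⁆) z)
    component = clique-component (K-clique free z∉) avoids-v (z , z∈K z) closed

  -- A connected P₃-free graph is complete, so for an edge uv the set V ∖ {u} is a
  -- clique component of G − u and Rule 1 or Rule 2 applies.
  P3Free⇒rule : Connected G → HasEdge G → P3Free Subset.⊥ → SomeRuleApplies G
  P3Free⇒rule conn (u , v , uv) free = clique-component⇒rule component clq
    where
    clq : Clique G (∁ ⁅ u ⁆)
    clq s t _ _ s≢t with P3Free-path free (conn s t (∈V s) (∈V t))
    ... | inj₁ s≡t = ⊥-elim (s≢t s≡t)
    ... | inj₂ st = st
    v∈ : v ∈ ∁ ⁅ u ⁆
    v∈ = x∉p⇒x∈∁p (x≢y⇒x∉⁅y⁆ (λ v≡u → edge⇒≢ uv (sym v≡u)))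
    component : ComponentMinus G ⁅ u ⁆ (∁ ⁅ u ⁆)
    component = clique-component clq (λ x∈ → x∈) (v , v∈) (λ _ _ _ y∈ _ → y∈)

  -- If a connected set C disjoint from an induced P₃ a – b – c contains every other
  -- vertex, then G − {a, b, c} is G[C], which is connected: Rule 3 applies.
  rule3 : ∀ {a b c C} → InducedP3 a b c → ConnectedIn G C → a ∉ C → b ∉ C → c ∉ C →
          (∀ d → d ∈ C ⊎ Among a b c d) → Rule3 G
  rule3 {a} {b} {c} {C} (ab , bc , a≢c , ¬ac) conn a∉ b∉ c∉ cover =
    a , b , c , ab , bc , a≢c , ¬ac , connected
    where
    C⊆ : C ⊆ ∁ (⁅ a ⁆ ∪ ⁅ b ⁆ ∪ ⁅ c ⁆)
    C⊆ x∈ = x∉p⇒x∈∁p λ x∈abc → among⇒∉ a∉ b∉ c∉ (∈triple⁻ x∈abc) x∈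
    ⊆C : ∁ (⁅ a ⁆ ∪ ⁅ b ⁆ ∪ ⁅ c ⁆) ⊆ C
    ⊆C {x} x∈ with cover x
    ... | inj₁ x∈C = x∈C
    ... | inj₂ x∈abc = ⊥-elim (x∈∁p⇒x∉p x∈ (∈triple⁺ x∈abc))
    connected : ConnectedIn G (∁ (⁅ a ⁆ ∪ ⁅ b ⁆ ∪ ⁅ c ⁆))
    connected u v u∈ v∈ = path-mono C⊆ (conn u v (⊆C u∈) (⊆C v∈))

  record Config (C : Subset n) : Set where
    field
      a b c     : Fin n
      induced   : InducedP3 a b c
      nonempty  : Nonempty C
      connected : ConnectedIn G C
      a∉C       : a ∉ C
      b∉C       : b ∉ C
      c∉C       : c ∉ C

  reverse : ∀ {C} → Config C → Config C
  reverse cfg = record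
    { a = c ; b = b ; c = a ; induced = reverseP3 induced ; nonempty = nonempty
    ; connected = connected ; a∉C = c∉C ; b∉C = b∉C ; c∉C = a∉C }
    where open Config cfg

  Maximal : Subset n → Set
  Maximal C = ∀ {w} → w ∉ C → Touches C w → P3Free (C ∪ ⁅ w ⁆)

  Extension : Subset n → Set
  Extension C = ∃ λ w → w ∉ C × Touches C w × HasP3Outside (C ∪ ⁅ w ⁆)

  extension? : ∀ C → Dec (Extension C)
  extension? C = any? λ w → ¬? (w ∈? C) ×-dec touches? C w ×-dec hasP3Outside? (C ∪ ⁅ w ⁆)

  ¬Extension⇒Maximal : ∀ {C} → ¬ Extension C → Maximal C
  ¬Extension⇒Maximal none {w} w∉ touch = ¬HasP3Outside⇒P3Free λ p3 → none (w , w∉ , touch , p3)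

  extend : ∀ {C w} → Config C → Touches C w → HasP3Outside (C ∪ ⁅ w ⁆) → Config (C ∪ ⁅ w ⁆)
  extend cfg (x , x∈ , xw) (p , q , r , p∉ , q∉ , r∉ , pqr) = record
    { a = p ; b = q ; c = r ; induced = pqr
    ; nonempty = proj₁ nonempty , p⊆p∪q _ (proj₂ nonempty)
    ; connected = connected-extend connected x∈ xw ; a∉C = p∉ ; b∉C = q∉ ; c∉C = r∉ }
    where open Config cfg

  -- Extending while possible terminates because C grows strictly: every configuration
  -- can be replaced by one on a maximal set.
  maximalise : ∀ {C} → Acc _⊃_ C → Config C → ∃ λ C′ → Config C′ × Maximal C′
  maximalise {C} (acc larger) cfg with extension? C
  ... | no none = C , cfg , ¬Extension⇒Maximal none
  ... | yes (w , w∉ , touch , p3) =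
        maximalise (larger C⊂C∪w) (extend cfg touch p3)
    where
    C⊂C∪w : (C ∪ ⁅ w ⁆) ⊃ C
    C⊂C∪w = p⊆p∪q _ , w , x∈p∪q⁺ {p = C} (inj₂ (x∈⁅x⁆ w)) , w∉

  module MaximalConfig {C} (cfg : Config C) (max : Maximal C) where
    open Config cfg

    ab : Edge G a b
    ab = proj₁ induced

    bc : Edge G b c
    bc = proj₁ (proj₂ induced)

    a≢c : a ≢ c
    a≢c = proj₁ (proj₂ (proj₂ induced))

    ¬ac : ¬ Edge G a c
    ¬ac = proj₂ (proj₂ (proj₂ induced))

    a≢b : a ≢ b
    a≢b = edge⇒≢ ab

    b≢c : b ≢ c
    b≢c = edge⇒≢ bc

    b≢a : b ≢ a
    b≢a b≡a = a≢b (sym b≡a)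

    c≢b : c ≢ b
    c≢b c≡b = b≢c (sym c≡b)

    c≢a : c ≢ a
    c≢a c≡a = a≢c (sym c≡a)

    -- Every neighbour of C outside C is a, b or c: otherwise the induced P₃ a – b – c
    -- would survive in G − (C ∪ {y}).
    touching⇒among : ∀ {y} → y ∉ C → Touches C y → Among a b c y
    touching⇒among {y} y∉ touch with among? a b c y
    ... | yes y∈abc = y∈abc
    ... | no ¬y∈abc = ⊥-elim (¬ac (max y∉ touch (outside a∉C inj₁)
                                    (outside b∉C (λ e → inj₂ (inj₁ e)))
                                    (outside c∉C (λ e → inj₂ (inj₂ e))) ab bc a≢c))
      where
      outside : ∀ {x} → x ∉ C → (y ≡ x → Among a b c y) → x ∉ C ∪ ⁅ y ⁆
      outside x∉ among = ∉∪⁅⁆ x∉ (λ x≡y → ¬y∈abc (among (sym x≡y)))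

    end-touches : Connected G → Touches C a ⊎ Touches C b ⊎ Touches C c
    end-touches conn with exit C (conn (proj₁ nonempty) a (∈V _) (∈V a)) (proj₂ nonempty) a∉C
    ... | x , y , x∈ , y∉ , xy with touching⇒among y∉ (x , x∈ , xy)
    ...   | inj₁ refl = inj₁ (x , x∈ , xy)
    ...   | inj₂ (inj₁ refl) = inj₂ (inj₁ (x , x∈ , xy))
    ...   | inj₂ (inj₂ refl) = inj₂ (inj₂ (x , x∈ , xy))

    touching-in-K : ∀ {v z s} → z ∉ C ∪ ⁅ v ⁆ → s ∈ K (C ∪ ⁅ v ⁆) z → Touches C s →
                    Among a b c s × s ≢ v
    touching-in-K {v} {z} {s} z∉ s∈ touch =
      touching⇒among (∉∪⁻ˡ s∉) touch , x∉⁅y⁆⇒x≢y (∉∪⁻ʳ C s∉)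
      where
      s∉ : s ∉ C ∪ ⁅ v ⁆
      s∉ = K-avoids z∉ s∈

    -- Only the end a has a neighbour in C.  Then the component of b in G − (C ∪ {a})
    -- could only reach C through b or c, so it is a clique component of G − a.
    one-end : Touches C a → ¬ Touches C b → ¬ Touches C c → SomeRuleApplies G
    one-end ta ¬tb ¬tc with component-or-touch (max a∉C ta) (∉∪⁅⁆ b∉C b≢a)
    ... | inj₁ rule = rule
    ... | inj₂ (s , s∈ , ts) with touching-in-K (∉∪⁅⁆ b∉C b≢a) s∈ ts
    ...   | inj₁ refl , s≢a = ⊥-elim (s≢a refl)
    ...   | inj₂ (inj₁ refl) , _ = ⊥-elim (¬tb ts)
    ...   | inj₂ (inj₂ refl) , _ = ⊥-elim (¬tc ts)

    module _ {d} (d∉C : d ∉ C) (¬d : ¬ Among a b c d) where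
      d≢a : d ≢ a
      d≢a d≡a = ¬d (inj₁ d≡a)

      d≢b : d ≢ b
      d≢b d≡b = ¬d (inj₂ (inj₁ d≡b))

      d≢c : d ≢ c
      d≢c d≡c = ¬d (inj₂ (inj₂ d≡c))

      -- If b touches C and d ∼ a, then d ≁ c: otherwise a – d – c forces a ∼ c in G − (C ∪ {b}).
      ¬dc : Touches C b → Edge G d a → ¬ Edge G d c
      ¬dc tb da dc =
        ¬ac (max b∉C tb (∉∪⁅⁆ a∉C a≢b) (∉∪⁅⁆ d∉C d≢b) (∉∪⁅⁆ c∉C c≢b) (edge-sym da) dc a≢c)

      -- If moreover a touches C, then d ≁ b: otherwise d – b – c forces d ∼ c in G − (C ∪ {a}).
      ¬db : Touches C a → Touches C b → Edge G d a → ¬ Edge G d b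
      ¬db ta tb da db =
        ¬dc tb da (max a∉C ta (∉∪⁅⁆ d∉C d≢a) (∉∪⁅⁆ b∉C b≢a) (∉∪⁅⁆ c∉C c≢a) db bc d≢c)

      -- a and b touch C and d ∼ a.  The component of d in G − (C ∪ {a}) could reach C
      -- only through b or c, which are not adjacent to d; so it is a clique component of G − a.
      adjacent-end : Touches C a → Touches C b → Edge G d a → SomeRuleApplies G
      adjacent-end ta tb da with component-or-touch (max a∉C ta) (∉∪⁅⁆ d∉C d≢a)
      ... | inj₁ rule = rule
      ... | inj₂ (s , s∈ , ts) with touching-in-K (∉∪⁅⁆ d∉C d≢a) s∈ ts | ∈K⁻ s∈
      ...   | s∈abc , _ | inj₁ refl = ⊥-elim (¬d s∈abc)
      ...   | inj₁ refl , s≢a | inj₂ _ = ⊥-elim (s≢a refl)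
      ...   | inj₂ (inj₁ refl) , _ | inj₂ (db , _) = ⊥-elim (¬db ta tb da db)
      ...   | inj₂ (inj₂ refl) , _ | inj₂ (dc , _) = ⊥-elim (¬dc tb da dc)

    -- With D = {a, c}, the
    -- component X of b in G − (C ∪ D) and C are the two components of G − D, and X ∪ {a},
    -- X ∪ {c} are cliques: Rule 4 applies, unless a stray vertex yields Rule 1 or 2.
    module TwoEnds (ta : Touches C a) (tc : Touches C c) (¬tb : ¬ Touches C b) where
      D : Subset n
      D = ⁅ a ⁆ ∪ ⁅ c ⁆

      X : Subset n
      X = K (C ∪ D) b

      free-a : P3Free (C ∪ ⁅ a ⁆)
      free-a = max a∉C ta

      free : P3Free (C ∪ D)
      free = P3Free-mono (∪-monoʳ (p⊆p∪q ⁅ c ⁆)) free-a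

      b∉ : b ∉ C ∪ D
      b∉ = ∉∪ b∉C (∉∪ (x≢y⇒x∉⁅y⁆ b≢a) (x≢y⇒x∉⁅y⁆ b≢c))

      no-touch : ∀ {t} → t ∉ C ∪ D → ¬ Touches C t
      no-touch {t} t∉ touch with touching⇒among (∉∪⁻ˡ t∉) touch
      ... | inj₁ refl = ∉∪⁻ʳ C t∉ (x∈p∪q⁺ (inj₁ (x∈⁅x⁆ a)))
      ... | inj₂ (inj₁ refl) = ¬tb touch
      ... | inj₂ (inj₂ refl) = ∉∪⁻ʳ C t∉ (x∈p∪q⁺ {p = ⁅ a ⁆} (inj₂ (x∈⁅x⁆ c)))

      X-component : ComponentMinus G D X
      X-component = clique-component (K-clique free b∉) X⊆ (b , z∈K b) closed
        where
        X⊆ : X ⊆ ∁ D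
        X⊆ x∈ = x∉p⇒x∈∁p (∉∪⁻ʳ C (K-avoids b∉ x∈))
        closed : Closed (∁ D) X
        closed s t s∈ t∈ st with t ∈? C
        ... | yes t∈C = ⊥-elim (no-touch (K-avoids b∉ s∈) (t , t∈C , edge-sym st))
        ... | no t∉C = K-closed free b∉ s t s∈ (x∉p⇒x∈∁p (∉∪ t∉C (x∈∁p⇒x∉p t∈))) st

      C-component : ComponentMinus G D C
      C-component = C⊆ , nonempty , connected , closed
        where
        C⊆ : C ⊆ ∁ D
        C⊆ x∈ = x∉p⇒x∈∁p (∉∪ (λ x∈a → a∉C (subst (_∈ C) (x∈⁅y⁆⇒x≡y a x∈a) x∈))
                              (λ x∈c → c∉C (subst (_∈ C) (x∈⁅y⁆⇒x≡y c x∈c) x∈)))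
        closed : Closed (∁ D) C
        closed x t x∈ t∈ xt with t ∈? C
        ... | yes t∈C = t∈C
        ... | no t∉C = ⊥-elim (no-touch (∉∪ t∉C (x∈∁p⇒x∉p t∈)) (x , x∈ , xt))

      X≢C : X ≢ C
      X≢C X≡C = b∉C (subst (b ∈_) X≡C (z∈K b))

      -- X ∪ {v} lies inside the clique K(b) of G − (C ∪ {u}), for {u, v} = {a, c}.
      X∪⁅a⁆-clique : Clique G (X ∪ ⁅ a ⁆)
      X∪⁅a⁆-clique = clique-⊆ (∪⁅⁆-⊆ (K-antitone (∪-monoʳ (q⊆p∪q ⁅ a ⁆ ⁅ c ⁆)))
                                     (∈K⁺ (edge-sym ab) (∉∪⁅⁆ a∉C a≢c)))
                              (K-clique (max c∉C tc) (∉∪⁅⁆ b∉C b≢c))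

      X∪⁅c⁆-clique : Clique G (X ∪ ⁅ c ⁆)
      X∪⁅c⁆-clique = clique-⊆ (∪⁅⁆-⊆ (K-antitone (∪-monoʳ (p⊆p∪q ⁅ c ⁆))) (∈K⁺ bc (∉∪⁅⁆ c∉C c≢a)))
                              (K-clique free-a (∉∪⁅⁆ b∉C b≢a))

      -- A vertex w outside D, X and C: its component in G − (C ∪ {a}) cannot reach C,
      -- since only c could and w ∼ c would put w into X.
      stray : ∀ {w} → w ∉ C ∪ ⁅ a ⁆ → w ∉ D → w ∉ X → SomeRuleApplies G
      stray {w} w∉ w∉D w∉X with component-or-touch free-a w∉
      ... | inj₁ rule = rule
      ... | inj₂ (s , s∈ , ts) with touching-in-K w∉ s∈ ts | ∈K⁻ s∈
      ...   | inj₁ refl , s≢a | _ = ⊥-elim (s≢a refl)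
      ...   | inj₂ (inj₁ refl) , _ | _ = ⊥-elim (¬tb ts)
      ...   | inj₂ (inj₂ refl) , _ | inj₁ refl = ⊥-elim (w∉D (x∈p∪q⁺ {p = ⁅ a ⁆} (inj₂ (x∈⁅x⁆ c))))
      ...   | inj₂ (inj₂ refl) , _ | inj₂ (wc , _) =
              ⊥-elim (w∉X (K-transfer w∈K (∉∪ (∉∪⁻ˡ w∉) w∉D)))
        where
        w∈K : w ∈ K (C ∪ ⁅ a ⁆) b
        w∈K = K-closed free-a (∉∪⁅⁆ b∉C b≢a) c _ (∈K⁺ bc (∉∪⁅⁆ c∉C c≢a)) (x∉p⇒x∈∁p w∉) (edge-sym wc)

      Covered : Fin n → Set
      Covered w = w ∉ D → w ∈ X ⊎ w ∈ C

      covered? : ∀ w → Dec (Covered w)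
      covered? w = ¬? (w ∈? D) →-dec ((w ∈? X) ⊎-dec (w ∈? C))

      two-ends : SomeRuleApplies G
      two-ends with all? covered?
      ... | yes cover = inj₂ (inj₂ (inj₂ (a , c , a≢c , ¬ac , X , C , X-component , C-component ,
                                           X≢C , cover , X∪⁅a⁆-clique , X∪⁅c⁆-clique)))
      ... | no ¬cover with ¬∀⟶∃¬ n Covered covered? ¬cover
      ...   | w , ¬covered = stray (∉∪ w∉C (λ w∈a → w∉D (x∈p∪q⁺ (inj₁ w∈a)))) w∉D w∉X
        where
        w∉D : w ∉ D
        w∉D w∈D = ¬covered (λ w∉D → ⊥-elim (w∉D w∈D))
        w∉X : w ∉ X
        w∉X w∈X = ¬covered (λ _ → inj₁ w∈X)
        w∉C : w ∉ C
        w∉C w∈C = ¬covered (λ _ → inj₂ w∈C)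

  -- The case split for a maximal configuration; it sits outside MaximalConfig because
  -- some cases use the reversed configuration.
  module _ {C} (cfg : Config C) (max : Maximal C) where
    open Config cfg
    open MaximalConfig cfg max

    -- The component of d in G − (C ∪ {b})
    -- is a clique component of G − b unless it reaches C through a or c, i.e. unless
    -- d ∼ a or d ∼ c; those cases are adjacent-end, for c after reversing the P₃.
    middle : ∀ {d} → d ∉ C → ¬ Among a b c d → Touches C b → SomeRuleApplies G
    middle d∉C ¬d tb with component-or-touch (max b∉C tb) (∉∪⁅⁆ d∉C (d≢b d∉C ¬d))
    ... | inj₁ rule = rule
    ... | inj₂ (s , s∈ , ts) with touching-in-K (∉∪⁅⁆ d∉C (d≢b d∉C ¬d)) s∈ ts | ∈K⁻ s∈
    ...   | s∈abc , _ | inj₁ refl = ⊥-elim (¬d s∈abc)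
    ...   | inj₁ refl , _ | inj₂ (da , _) = adjacent-end d∉C ¬d ts tb da
    ...   | inj₂ (inj₁ refl) , s≢b | inj₂ _ = ⊥-elim (s≢b refl)
    ...   | inj₂ (inj₂ refl) , _ | inj₂ (dc , _) =
            MaximalConfig.adjacent-end (reverse cfg) max d∉C (λ d∈cba → ¬d (among-reverse d∈cba))
                                       ts tb dc

    Placed : Fin n → Set
    Placed d = d ∈ C ⊎ Among a b c d

    placed? : ∀ d → Dec (Placed d)
    placed? d = (d ∈? C) ⊎-dec among? a b c d

    resolve : Connected G → SomeRuleApplies G
    resolve conn with all? placed?
    ... | yes cover = inj₂ (inj₂ (inj₁ (rule3 induced connected a∉C b∉C c∉C cover)))
    ... | no ¬cover with ¬∀⟶∃¬ n Placed placed? ¬cover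
    ...   | d , ¬covered with touches? C b | touches? C a | touches? C c
    ...     | yes tb | _ | _ =
              middle (λ d∈C → ¬covered (inj₁ d∈C)) (λ d∈abc → ¬covered (inj₂ d∈abc)) tb
    ...     | no ¬tb | yes ta | yes tc = TwoEnds.two-ends ta tc ¬tb
    ...     | no ¬tb | yes ta | no ¬tc = one-end ta ¬tb ¬tc
    ...     | no ¬tb | no ¬ta | yes tc = MaximalConfig.one-end (reverse cfg) max tc ¬tb ¬ta
    ...     | no ¬tb | no ¬ta | no ¬tc with end-touches conn
    ...       | inj₁ ta = ⊥-elim (¬ta ta)
    ...       | inj₂ (inj₁ tb) = ⊥-elim (¬tb tb)
    ...       | inj₂ (inj₂ tc) = ⊥-elim (¬tc tc)

  seed : ∀ {a b c d} → InducedP3 a b c → ¬ Among a b c d → Config ⁅ d ⁆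
  seed {a} {b} {c} {d} p3 ¬d = record
    { a = a ; b = b ; c = c ; induced = p3 ; nonempty = d , x∈⁅x⁆ d
    ; connected = clique⇒connected singleton-clique
    ; a∉C = off (inj₁ refl) ; b∉C = off (inj₂ (inj₁ refl)) ; c∉C = off (inj₂ (inj₂ refl)) }
    where
    off : ∀ {x} → Among a b c x → x ∉ ⁅ d ⁆
    off x∈abc x∈d = ¬d (subst (Among a b c) (x∈⁅y⁆⇒x≡y d x∈d) x∈abc)
    singleton-clique : Clique G ⁅ d ⁆
    singleton-clique u v u∈ v∈ u≢v =
      ⊥-elim (u≢v (trans (x∈⁅y⁆⇒x≡y d u∈) (sym (x∈⁅y⁆⇒x≡y d v∈))))

  -- Given an induced P₃ a – b – c: either it covers G, so G − {a, b, c} is empty and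
  -- Rule 3 applies, or a vertex d off the P₃ seeds a configuration, which is enlarged
  -- to a maximal one and resolved.
  inducedP3⇒rule : ∀ {a b c} → Connected G → InducedP3 a b c → SomeRuleApplies G
  inducedP3⇒rule {a} {b} {c} conn p3 with all? (among? a b c)
  ... | yes all =
        inj₂ (inj₂ (inj₁ (rule3 p3 (λ _ _ u∈ → ⊥-elim (∉⊥ u∈)) ∉⊥ ∉⊥ ∉⊥ (λ d → inj₂ (all d)))))
  ... | no ¬all with ¬∀⟶∃¬ n (Among a b c) (among? a b c) ¬all
  ...   | d , ¬d with maximalise (⊃-wellFounded ⁅ d ⁆) (seed p3 ¬d)
  ...     | C , cfg , max = resolve cfg max conn

lemma6 : ∀ (n : ℕ) (G : Graph n) → Connected G → HasEdge G → SomeRuleApplies G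
lemma6 n G conn edge with hasP3Outside? G Subset.⊥
... | yes (a , b , c , _ , _ , _ , p3) = inducedP3⇒rule G conn p3
... | no none = P3Free⇒rule G conn edge (¬HasP3Outside⇒P3Free G none)
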